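{- For every integer $d\ge 1$, the hypercube $Q_d$ satisfies $\zeta^*(Q_d)\le d+1$.
   Context: $Q_1=K_2$ and $Q_d=K_2\square Q_{d-1}$, where $\square$ is the Cartesian product of graphs (vertex set $V(G)\times V(H)$, $(u,v)\sim(u',v')$ iff $u\sim u'$ and $v=v'$, or $u=u'$ and $v\sim v'$). The centroidal localization game on a graph with parameter $k$: the robber is secretly placed at a vertex $r$; at each turn the Cop-player probes a set $\{v_1,\dots,v_k\}$ of (at most) $k$ vertices and learns, for each $v_i$, whether $d(v_i,r)=0$, and for every $i<j$ whether $d(v_i,r)$ is $<$, $=$ or $>$ $d(v_j,r)$ ($d$ = graph distance). If all information gathered uniquely determines the robber's current position, the Cop-player wins; otherwise the robber may move along one edge (or stay). The robber wins if never located. $\zeta^*$ of a graph is the minimum $k$ for which the Cop-player has a strategy winning against every robber strategy. -}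

module Defs where

open import Data.Nat using (ℕ; zero; suc; _≤_; _<_)
open import Data.Fin as Fin using (Fin)
open import Data.Bool using (Bool; true; false)
open import Data.Unit using (⊤; tt)
open import Data.Empty using (⊥)
open import Data.Product using (Σ; ∃; _×_; _,_)
open import Data.Sum using (_⊎_)
open import Data.List using (List; map; upTo)
open import Relation.Nullary using (¬_)
open import Relation.Binary.PropositionalEquality using (_≡_; _≢_)
open import Function.Bundles using (_⇔_)

record Graph : Set₁ where
  field
    V   : Set
    Adj : V → V → Set
open Graph public

-- K₁ (only used as a dummy value for Q 0; the theorem assumes d ≥ 1)
K1 : Graph
K1 = record { V = ⊤ ; Adj = λ _ _ → ⊥ }

K2 : Graph
K2 = record { V = Bool ; Adj = λ x y → x ≢ y }

_□_ : Graph → Graph → Graph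
G □ H = record
  { V   = V G × V H
  ; Adj = λ { (u , v) (u' , v') →
              (Adj G u u' × v ≡ v') ⊎ (u ≡ u' × Adj H v v') } }

Q : ℕ → Graph
Q zero = K1
Q (suc zero) = K2
Q (suc (suc n)) = K2 □ Q (suc n)

data Walk (G : Graph) : ℕ → V G → V G → Set where
  nil  : ∀ {u} → Walk G zero u u
  cons : ∀ {n u v w} → Adj G u v → Walk G n v w → Walk G (suc n) u w

IsDist : (G : Graph) → V G → V G → ℕ → Set
IsDist G u v n = Walk G n u v × (∀ m → Walk G m u v → n ≤ m)

data Cmp : Set where
  LT EQ GT : Cmp

cmpℕ : ℕ → ℕ → Cmp
cmpℕ zero zero = EQ
cmpℕ zero (suc _) = LT
cmpℕ (suc _) zero = GT
cmpℕ (suc m) (suc n) = cmpℕ m n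

-- a probe: the (at most k) probed vertices v₁ … v_k (repetitions allowed)
Probe : Graph → ℕ → Set
Probe G k = Fin k → V G

record Answer (k : ℕ) : Set where
  field
    isZero : Fin k → Bool
    cmp    : (i j : Fin k) → i Fin.< j → Cmp
open Answer public

Answers : (G : Graph) {k : ℕ} → Probe G k → V G → Answer k → Set
Answers G {k} ps r ans =
  (∀ i a → IsDist G (ps i) r a → (isZero ans i ≡ true ⇔ a ≡ 0)) ×
  (∀ i j (p : i Fin.< j) a b → IsDist G (ps i) r a → IsDist G (ps j) r b →
     cmpℕ a b ≡ cmp ans i j p)

CopStrategy : Graph → ℕ → Set
CopStrategy G k = List (Answer k) → Probe G k

RobberWalk : (G : Graph) → (ℕ → V G) → Set
RobberWalk G w = ∀ t → w (suc t) ≡ w t ⊎ Adj G (w t) (w (suc t))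

module _ {G : Graph} {k : ℕ} (σ : CopStrategy G k) (ans : ℕ → Answer k) where

  history : ℕ → List (Answer k)
  history t = map ans (upTo t)

  probeAt : ℕ → Probe G k
  probeAt t = σ (history t)

  ValidPlay : (ℕ → V G) → Set
  ValidPlay w = ∀ t → Answers G (probeAt t) (w t) (ans t)

  Located : (ℕ → V G) → ℕ → Set
  Located w t = ∀ w' → RobberWalk G w' →
                (∀ s → s ≤ t → Answers G (probeAt s) (w' s) (ans s)) →
                w' t ≡ w t

CopWins : Graph → ℕ → Set
CopWins G k = Σ (CopStrategy G k) λ σ →
  ∀ w → RobberWalk G w → ∀ ans → ValidPlay {G} {k} σ ans w → ∃ λ t → Located {G} {k} σ ans w t

ZetaStar≤ : Graph → ℕ → Set
ZetaStar≤ G m = Σ ℕ λ k → k ≤ m × CopWins G k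

module Submission where

-- Write the vertices of Q_d as bit vectors.  The graph distance
-- of Q_d is the Hamming distance, and for the origin 0 and the unit vector
-- eᵢ we have d(eᵢ, r) = d(0, r) - 1 if rᵢ = 1 and d(0, r) + 1 if rᵢ = 0.
-- Hence probing the d + 1 vertices 0, e₁, …, e_d, the single comparison of
-- d(0, r) with d(eᵢ, r) reveals the i-th bit of r, so one round of probing
-- already determines the robber's position.

open import Defs
open import Data.Nat using (ℕ; zero; suc; _≤_; _+_; z≤n; s≤s)
open import Data.Nat.Properties using (≤-trans; ≤-reflexive; ≤-refl; +-monoˡ-≤; +-monoʳ-≤; +-suc)
open import Data.Fin as Fin using (Fin)
open import Data.Bool using (Bool; true; false)
open import Data.Product using (∃; _,_)
open import Data.Sum using (inj₁; inj₂)
open import Relation.Binary.PropositionalEquality using (_≡_; refl; sym; trans; cong₂; module ≡-Reasoning)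

Resolving : (G : Graph) {k : ℕ} → Probe G k → Set
Resolving G ps = ∀ r r' ans → Answers G ps r ans → Answers G ps r' ans → r' ≡ r

resolving⇒copWins : (G : Graph) {k : ℕ} (ps : Probe G k) → Resolving G ps → CopWins G k
resolving⇒copWins G {k} ps resolves = (λ _ → ps) , locate
  where
  locate : ∀ w → RobberWalk G w → ∀ ans → ValidPlay {G} {k} (λ _ → ps) ans w →
           ∃ λ t → Located {G} {k} (λ _ → ps) ans w t
  locate w _ ans valid = 0 , λ w' _ consistent →
    resolves (w 0) (w' 0) (ans 0) (valid 0) (consistent 0 z≤n)

distance-from-bounds :
  (G : Graph) (D : V G → V G → ℕ) →
  (∀ u → D u u ≡ 0) →
  (∀ {u u'} v → Adj G u u' → D u v ≤ suc (D u' v)) →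
  (∀ u v → Walk G (D u v) u v) →
  ∀ u v → IsDist G u v (D u v)
distance-from-bounds G D D-refl D-step D-walk u v = D-walk u v , λ _ → lowerBound
  where
  lowerBound : ∀ {m u v} → Walk G m u v → D u v ≤ m
  lowerBound {u = u} nil = ≤-reflexive (D-refl u)
  lowerBound {v = v} (cons a walk) = ≤-trans (D-step v a) (s≤s (lowerBound walk))

-- Cube n is Q (n + 1): vertices are Bool for n = 0 and Bool × Cube (n - 1)
-- otherwise, so every n is a legitimate index.
Cube : ℕ → Graph
Cube n = Q (suc n)

bitDistance : Bool → Bool → ℕ
bitDistance true  true  = 0
bitDistance false false = 0
bitDistance true  false = 1
bitDistance false true  = 1

bitDistance≤1 : ∀ b c → bitDistance b c ≤ 1
bitDistance≤1 true  true  = z≤n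
bitDistance≤1 false false = z≤n
bitDistance≤1 true  false = s≤s z≤n
bitDistance≤1 false true  = s≤s z≤n

hamming : (n : ℕ) → V (Cube n) → V (Cube n) → ℕ
hamming zero    b       c       = bitDistance b c
hamming (suc n) (b , u) (c , v) = bitDistance b c + hamming n u v

hamming-refl : (n : ℕ) (u : V (Cube n)) → hamming n u u ≡ 0
hamming-refl zero    true        = refl
hamming-refl zero    false       = refl
hamming-refl (suc n) (true  , u) = hamming-refl n u
hamming-refl (suc n) (false , u) = hamming-refl n u

-- Moving along an edge changes one bit, hence the Hamming distance by ≤ 1.
hamming-step : (n : ℕ) {u u' : V (Cube n)} (v : V (Cube n)) →
               Adj (Cube n) u u' → hamming n u v ≤ suc (hamming n u' v)
hamming-step zero {b} c _ = ≤-trans (bitDistance≤1 b c) (s≤s z≤n)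
hamming-step (suc n) {b , u} (c , v) (inj₁ (_ , refl)) =
  +-monoˡ-≤ (hamming n u v) (≤-trans (bitDistance≤1 b c) (s≤s z≤n))
hamming-step (suc n) {b , u} {_ , u'} (c , v) (inj₂ (refl , a)) =
  ≤-trans (+-monoʳ-≤ (bitDistance b c) (hamming-step n v a))
          (≤-reflexive (+-suc (bitDistance b c) (hamming n u' v)))

liftWalk : ∀ n {m u v} (b : Bool) → Walk (Cube n) m u v → Walk (Cube (suc n)) m (b , u) (b , v)
liftWalk n b nil          = nil
liftWalk n b (cons a walk) = cons (inj₂ (refl , a)) (liftWalk n b walk)

hamming-walk : (n : ℕ) (u v : V (Cube n)) → Walk (Cube n) (hamming n u v) u v
hamming-walk zero    true        true        = nil
hamming-walk zero    false       false       = nil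
hamming-walk zero    true        false       = cons (λ ()) nil
hamming-walk zero    false       true        = cons (λ ()) nil
hamming-walk (suc n) (true  , u) (true  , v) = liftWalk n true  (hamming-walk n u v)
hamming-walk (suc n) (false , u) (false , v) = liftWalk n false (hamming-walk n u v)
hamming-walk (suc n) (true  , u) (false , v) = cons (inj₁ ((λ ()) , refl)) (liftWalk n false (hamming-walk n u v))
hamming-walk (suc n) (false , u) (true  , v) = cons (inj₁ ((λ ()) , refl)) (liftWalk n true  (hamming-walk n u v))

hamming-isDist : (n : ℕ) (u v : V (Cube n)) → IsDist (Cube n) u v (hamming n u v)
hamming-isDist n = distance-from-bounds (Cube n) (hamming n) (hamming-refl n) (hamming-step n) (hamming-walk n)

origin : (n : ℕ) → V (Cube n)
origin zero    = false
origin (suc n) = false , origin n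

unit : (n : ℕ) → Fin (suc n) → V (Cube n)
unit zero    _           = true
unit (suc n) Fin.zero    = true , origin n
unit (suc n) (Fin.suc i) = false , unit n i

bit : (n : ℕ) → Fin (suc n) → V (Cube n) → Bool
bit zero    _           b       = b
bit (suc n) Fin.zero    (b , _) = b
bit (suc n) (Fin.suc i) (_ , u) = bit n i u

bits-determine : (n : ℕ) (r r' : V (Cube n)) → (∀ i → bit n i r ≡ bit n i r') → r ≡ r'
bits-determine zero    r       r'      same = same Fin.zero
bits-determine (suc n) (b , u) (c , v) same =
  cong₂ _,_ (same Fin.zero) (bits-determine n u v (λ i → same (Fin.suc i)))

-- The outcome of comparing d(0, r) with d(eᵢ, r): eᵢ is closer iff rᵢ = 1.
side : Bool → Cmp
side false = LT
side true  = GT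

side-injective : ∀ {b c} → side b ≡ side c → b ≡ c
side-injective {true}  {true}  _ = refl
side-injective {false} {false} _ = refl
side-injective {true}  {false} ()
side-injective {false} {true}  ()

cmpℕ-suc-right : ∀ h → cmpℕ h (suc h) ≡ LT
cmpℕ-suc-right zero    = refl
cmpℕ-suc-right (suc h) = cmpℕ-suc-right h

cmpℕ-suc-left : ∀ h → cmpℕ (suc h) h ≡ GT
cmpℕ-suc-left zero    = refl
cmpℕ-suc-left (suc h) = cmpℕ-suc-left h

cmpℕ-cancel-+ : ∀ x a b → cmpℕ (x + a) (x + b) ≡ cmpℕ a b
cmpℕ-cancel-+ zero    a b = refl
cmpℕ-cancel-+ (suc x) a b = cmpℕ-cancel-+ x a b

-- On the first coordinate the two distances differ by exactly one; on the
-- other coordinates the first bit contributes equally to both.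
compare-origin-unit : (n : ℕ) (i : Fin (suc n)) (r : V (Cube n)) →
  cmpℕ (hamming n (origin n) r) (hamming n (unit n i) r) ≡ side (bit n i r)
compare-origin-unit zero    _           false       = refl
compare-origin-unit zero    _           true        = refl
compare-origin-unit (suc n) Fin.zero    (false , v) = cmpℕ-suc-right (hamming n (origin n) v)
compare-origin-unit (suc n) Fin.zero    (true  , v) = cmpℕ-suc-left (hamming n (origin n) v)
compare-origin-unit (suc n) (Fin.suc i) (c , v)     =
  trans (cmpℕ-cancel-+ (bitDistance false c) (hamming n (origin n) v) (hamming n (unit n i) v))
        (compare-origin-unit n i v)

cubeProbe : (n : ℕ) → Probe (Cube n) (suc (suc n))
cubeProbe n Fin.zero    = origin n
cubeProbe n (Fin.suc i) = unit n i

bit-from-answer : (n : ℕ) (r : V (Cube n)) (ans : Answer (suc (suc n))) →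
  Answers (Cube n) (cubeProbe n) r ans → ∀ i →
  side (bit n i r) ≡ cmp ans Fin.zero (Fin.suc i) (s≤s z≤n)
bit-from-answer n r ans (_ , compared) i = begin
  side (bit n i r)                                              ≡⟨ sym (compare-origin-unit n i r) ⟩
  cmpℕ (hamming n (origin n) r) (hamming n (unit n i) r)        ≡⟨ compared Fin.zero (Fin.suc i) (s≤s z≤n) _ _
                                                                     (hamming-isDist n (origin n) r)
                                                                     (hamming-isDist n (unit n i) r) ⟩
  cmp ans Fin.zero (Fin.suc i) (s≤s z≤n)                        ∎
  where open ≡-Reasoning

cubeProbe-resolving : (n : ℕ) → Resolving (Cube n) (cubeProbe n)
cubeProbe-resolving n r r' ans answers answers' =
  bits-determine n r' r λ i →
    side-injective (trans (bit-from-answer n r' ans answers' i) (sym (bit-from-answer n r ans answers i)))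

mainTheorem8 : (d : ℕ) → 1 ≤ d → ZetaStar≤ (Q d) (suc d)
mainTheorem8 zero    ()
mainTheorem8 (suc n) _ =
  suc (suc n) , ≤-refl , resolving⇒copWins (Cube n) (cubeProbe n) (cubeProbe-resolving n)
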